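{- For disjunctive systems, for every $n\ge|B|+1$: if $(A,B)^{(1,n)}$ has a deadlock, then $(A,B)^{(1,n+1)}$ has a deadlock.
   Context: Guarded systems. Fix disjoint finite sets $Q_A,Q_B$; $|B|$ denotes $|Q_B|$. A process template is $U=(Q_U,\mathit{init}_U,\Sigma_U,\delta_U)$ for $U\in\{A,B\}$: finite states, initial state, finite input alphabet, guarded transitions $\delta_U\subseteq Q_U\times\Sigma_U\times2^{Q_A\cup Q_B}\times Q_U$. The system $(A,B)^{(1,n)}$ has processes $A,B_1,\dots,B_n$ ($B_i$ copies of $B$); a global state $s$ gives each process $p$ a local state $s(p)$, a global input $e$ gives each $p$ an input $e(p)$; initially all processes are in their initial states. A local transition $(q,\sigma,g,q')$ of $p$ is enabled in $(s,e)$ if $s(p)=q$, $e(p)=\sigma$ and (disjunctive) some process $p'\neq p$ has $s(p')\in g$; $p$ is enabled if some transition of $p$ is. Exactly one process moves per global step. A path is a sequence $(s_1,e_1,p_1)(s_2,e_2,p_2)\dots$ where $s_{j+1}$ results from $s_j$ by an enabled transition of $p_j$ under $e_j$, $e_{j+1}(p)=e_j(p)$ for $p\ne p_j$, and a configuration $(s,e,\bot)$ occurs (as last) exactly when all processes are disabled. A run is a maximal path from the initial state. A run is globally deadlocked if it is finite; an infinite run is locally deadlocked if some process is disabled at all moments from some point on. A system has a deadlock if it has a globally or locally deadlocked run. -}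

module Defs where

open import Data.Nat using (ℕ; zero; suc; _≤_; _<_)
open import Data.Fin using (Fin)
open import Data.Bool using (Bool; true)
open import Data.Sum using (_⊎_; inj₁; inj₂)
open import Data.Product using (Σ; _×_; _,_; ∃; ∃-syntax)
open import Data.List using (List)
open import Data.List.Membership.Propositional using (_∈_)
open import Relation.Nullary using (¬_)
open import Relation.Binary.PropositionalEquality using (_≡_)

-- Local state sets: Q_A = Fin a, Q_B = Fin b (so |B| = b); their disjoint
-- union Q_A ∪ Q_B is Fin a ⊎ Fin b.
-- A guard g ∈ 2^(Q_A ∪ Q_B) is given by its characteristic function.
Guard : ℕ → ℕ → Set
Guard a b = Fin a ⊎ Fin b → Bool

record Template (Q : Set) (a b : ℕ) : Set where
  field
    nΣ   : ℕ
    init : Q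
    δ    : List (Q × Fin nΣ × Guard a b × Q)
open Template public

data Proc (n : ℕ) : Set where
  pA : Proc n
  pB : Fin n → Proc n

module System {a b : ℕ} (A : Template (Fin a) a b) (B : Template (Fin b) a b)
              (n : ℕ) where

  LQ : Proc n → Set
  LQ pA     = Fin a
  LQ (pB _) = Fin b

  tmpl : (p : Proc n) → Template (LQ p) a b
  tmpl pA     = A
  tmpl (pB _) = B

  LΣ : Proc n → Set
  LΣ p = Fin (nΣ (tmpl p))

  tag : (p : Proc n) → LQ p → Fin a ⊎ Fin b
  tag pA     q = inj₁ q
  tag (pB _) q = inj₂ q

  GState : Set
  GState = (p : Proc n) → LQ p

  GInput : Set
  GInput = (p : Proc n) → LΣ p

  initState : GState
  initState p = init (tmpl p)

  Trans : Proc n → Set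
  Trans p = LQ p × LΣ p × Guard a b × LQ p

  EnabledTrans : GState → GInput → (p : Proc n) → Trans p → Set
  EnabledTrans s e p (q , σ , g , q') =
    (q , σ , g , q') ∈ δ (tmpl p) × s p ≡ q × e p ≡ σ ×
    ∃[ p' ] (¬ p' ≡ p × g (tag p' (s p')) ≡ true)

  Enabled : GState → GInput → Proc n → Set
  Enabled s e p = Σ (Trans p) (EnabledTrans s e p)

  Disabled : GState → GInput → Proc n → Set
  Disabled s e p = ¬ Enabled s e p

  target : {p : Proc n} → Trans p → LQ p
  target (_ , _ , _ , q') = q'

  Step : GState → GInput → Proc n → GState → GInput → Set
  Step s e p s' e' =
    Σ (Trans p) λ t → EnabledTrans s e p t × s' p ≡ target t ×
      (∀ p' → ¬ p' ≡ p → s' p' ≡ s p') ×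
      (∀ p' → ¬ p' ≡ p → e' p' ≡ e p')

  record FiniteRun : Set where
    field
      len   : ℕ
      st    : ℕ → GState
      inp   : ℕ → GInput
      mv    : ℕ → Proc n
      start : ∀ p → st 0 p ≡ initState p
      steps : ∀ j → j < len → Step (st j) (inp j) (mv j) (st (suc j)) (inp (suc j))
      final : ∀ p → Disabled (st len) (inp len) p

  record InfiniteRun : Set where
    field
      st    : ℕ → GState
      inp   : ℕ → GInput
      mv    : ℕ → Proc n
      start : ∀ p → st 0 p ≡ initState p
      steps : ∀ j → Step (st j) (inp j) (mv j) (st (suc j)) (inp (suc j))

  -- globally deadlocked run = finite run; locally deadlocked infinite run:
  LocallyDeadlocked : InfiniteRun → Set
  LocallyDeadlocked r =
    ∃[ p ] ∃[ j ] (∀ k → j ≤ k → Disabled (InfiniteRun.st r k) (InfiniteRun.inp r k) p)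

  HasDeadlock : Set
  HasDeadlock = FiniteRun ⊎ Σ InfiniteRun LocallyDeadlocked

HasDeadlock : {a b : ℕ} → Template (Fin a) a b → Template (Fin b) a b → ℕ → Set
HasDeadlock A B n = System.HasDeadlock A B n

module Submission where

-- Idea: add to (A,B)^(1,n) a fresh process, the clone, that shadows one chosen
-- copy B_i.  The run of (A,B)^(1,n+1) replays the given run, and right after
-- every step of B_i the clone performs the same local transition.  The clone
-- is therefore always in a state that B_i occupies or has just left, so
--   * every step of the old run stays enabled (adding a process only adds
--     witnesses for disjunctive guards), and the clone's step is enabled
--     because B_i's step was;
--   * a process disabled in the old run stays disabled, as long as whatever
--     the clone's state satisfies is already witnessed by another process:
--     for a global deadlock choose B_i sharing its final state with some other
--     B_k (pigeonhole, this needs n > |B|); for a local deadlock of p choose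
--     any B_i different from p (this needs n ≥ 2).

open import Defs
open import Data.Nat using (ℕ; zero; suc; _+_; _≤_; _<_; _≤′_; ≤′-refl; ≤′-step; s≤s; z≤n)
open import Data.Nat.Properties
  using (≤-refl; ≤-trans; ≤-reflexive; <⇒≤; <-≤-trans; ≰⇒>; <⇒≱; ≤⇒≤′;
         n≤1+n; m≤n⇒m≤1+n; +-suc; +-comm; +-mono-≤; +-monoʳ-≤)
open import Data.Fin using (Fin; zero; suc)
open import Data.Fin.Properties using (pigeonhole; <⇒≢) renaming (_≟_ to _≟F_)
open import Data.Bool using (true)
open import Data.Empty using (⊥-elim)
open import Data.Sum using (_⊎_; inj₁; inj₂)
import Data.Sum as Sum
open import Data.Product using (Σ; _×_; _,_; ∃-syntax; proj₁; proj₂)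
open import Data.List.Membership.Propositional using (_∈_)
open import Function using (_∘_)
open import Relation.Nullary using (Dec; yes; no)
open import Relation.Binary.PropositionalEquality
  using (_≡_; _≢_; refl; sym; trans; cong; subst; subst₂)

stepwise-monotone : (f : ℕ → ℕ) → (∀ k → f k ≤ f (suc k)) → ∀ {k k'} → k ≤ k' → f k ≤ f k'
stepwise-monotone f up {k} k≤k' = go (≤⇒≤′ k≤k')
  where
  go : ∀ {k'} → k ≤′ k' → f k ≤ f k'
  go ≤′-refl       = ≤-refl
  go (≤′-step k≤m) = ≤-trans (go k≤m) (up _)

inhabited-positive : ∀ {m} → Fin m → 0 < m
inhabited-positive zero    = s≤s z≤n
inhabited-positive (suc _) = s≤s z≤n

another-B : ∀ {n} (p : Proc n) → 2 ≤ n → ∃[ i ] pB i ≢ p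
another-B pA           (s≤s (s≤s _)) = zero , λ ()
another-B (pB zero)    (s≤s (s≤s _)) = suc zero , λ ()
another-B (pB (suc _)) (s≤s (s≤s _)) = zero , λ ()

module Shadow {a b : ℕ} (A : Template (Fin a) a b) (B : Template (Fin b) a b) (n : ℕ) where
  module O = System A B n
  module N = System A B (suc n)

  _≟P_ : (p q : Proc n) → Dec (p ≡ q)
  pA   ≟P pA   = yes refl
  pA   ≟P pB _ = no λ ()
  pB _ ≟P pA   = no λ ()
  pB x ≟P pB y with x ≟F y
  ... | yes refl = yes refl
  ... | no x≢y   = no λ { refl → x≢y refl }

  pB-injective : ∀ {x y : Fin n} → pB x ≡ pB y → x ≡ y
  pB-injective refl = refl

  -- The old processes reappear with B_x renamed to B_(x+1); B_0 is the clone.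
  emb : Proc n → Proc (suc n)
  emb pA     = pA
  emb (pB x) = pB (suc x)

  clone : Proc (suc n)
  clone = pB zero

  emb-injective : ∀ {p q} → emb p ≡ emb q → p ≡ q
  emb-injective {pA}   {pA}   refl = refl
  emb-injective {pB _} {pB _} refl = refl

  emb≢clone : ∀ p → emb p ≢ clone
  emb≢clone pA ()
  emb≢clone (pB _) ()

  extend : O.GState → Fin b → N.GState
  extend s c pA           = s pA
  extend s c (pB zero)    = c
  extend s c (pB (suc x)) = s (pB x)

  extendInput : O.GInput → Fin (nΣ B) → N.GInput
  extendInput e d pA           = e pA
  extendInput e d (pB zero)    = d
  extendInput e d (pB (suc x)) = e (pB x)

  extend-frame : ∀ {s s' c} p → (∀ p' → p' ≢ p → s' p' ≡ s p')
    → ∀ P → P ≢ emb p → extend s' c P ≡ extend s c P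
  extend-frame p fr pA           P≢p = fr pA (P≢p ∘ cong emb)
  extend-frame p fr (pB zero)    P≢p = refl
  extend-frame p fr (pB (suc x)) P≢p = fr (pB x) (P≢p ∘ cong emb)

  extendInput-frame : ∀ {e e' d} p → (∀ p' → p' ≢ p → e' p' ≡ e p')
    → ∀ P → P ≢ emb p → extendInput e' d P ≡ extendInput e d P
  extendInput-frame p fr pA           P≢p = fr pA (P≢p ∘ cong emb)
  extendInput-frame p fr (pB zero)    P≢p = refl
  extendInput-frame p fr (pB (suc x)) P≢p = fr (pB x) (P≢p ∘ cong emb)

  extend-clone-frame : ∀ s c c' P → P ≢ clone → extend s c' P ≡ extend s c P
  extend-clone-frame s c c' pA           _ = refl
  extend-clone-frame s c c' (pB zero)    P≢clone = ⊥-elim (P≢clone refl)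
  extend-clone-frame s c c' (pB (suc x)) _ = refl

  extendInput-clone-frame : ∀ e d d' P → P ≢ clone → extendInput e d' P ≡ extendInput e d P
  extendInput-clone-frame e d d' pA           _ = refl
  extendInput-clone-frame e d d' (pB zero)    P≢clone = ⊥-elim (P≢clone refl)
  extendInput-clone-frame e d d' (pB (suc x)) _ = refl

  Witnessed : ∀ {m} → System.GState A B m → Proc m → Guard a b → Set
  Witnessed {m} s p g = ∃[ p' ] (p' ≢ p × g (System.tag A B m p' (s p')) ≡ true)

  tag-emb : ∀ {s c} p → N.tag (emb p) (extend s c (emb p)) ≡ O.tag p (s p)
  tag-emb pA     = refl
  tag-emb (pB _) = refl

  witness-emb : ∀ {s c g p} → Witnessed s p g → Witnessed (extend s c) (emb p) g
  witness-emb {g = g} (p' , p'≢p , sat) =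
    emb p' , p'≢p ∘ emb-injective , trans (cong g (tag-emb p')) sat

  witness-clone : ∀ {s c g} p' → g (O.tag p' (s p')) ≡ true → Witnessed (extend s c) clone g
  witness-clone {g = g} p' sat = emb p' , emb≢clone p' , trans (cong g (tag-emb p')) sat

  witness-emb-back : ∀ {s c g} p → Witnessed (extend s c) (emb p) g
    → Witnessed s p g ⊎ g (inj₂ c) ≡ true
  witness-emb-back p (pA         , ne , sat) = inj₁ (pA , ne ∘ cong emb , sat)
  witness-emb-back p (pB zero    , ne , sat) = inj₂ sat
  witness-emb-back p (pB (suc x) , ne , sat) = inj₁ (pB x , ne ∘ cong emb , sat)

  witness-clone-back : ∀ {s c g} → Witnessed (extend s c) clone g
    → ∃[ p' ] g (O.tag p' (s p')) ≡ true
  witness-clone-back (pA         , _  , sat) = pA , sat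
  witness-clone-back (pB zero    , ne , _)   = ⊥-elim (ne refl)
  witness-clone-back (pB (suc x) , _  , sat) = pB x , sat

  source : ∀ {p} → O.Trans p → O.LQ p
  source (q , _ , _ , _) = q

  label : ∀ {p} → O.Trans p → O.LΣ p
  label (_ , σ , _ , _) = σ

  guard : ∀ {p} → O.Trans p → Guard a b
  guard (_ , _ , g , _) = g

  record Ready (s : O.GState) (e : O.GInput) (p : Proc n) (t : O.Trans p) : Set where
    constructor ready
    field
      listed      : t ∈ δ (O.tmpl p)
      at-source   : s p ≡ source t
      reads-label : e p ≡ label t

  ready-enabled : ∀ {s e p} t → Ready s e p t → Witnessed s p (guard t) → O.Enabled s e p
  ready-enabled t (ready listed at-q reads-σ) w = t , listed , at-q , reads-σ , w

  ready-frame : ∀ {s e s' e' p} t → s' p ≡ s p → e' p ≡ e p → Ready s' e' p t → Ready s e p t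
  ready-frame t same-state same-input (ready listed at-q reads-σ) =
    ready listed (trans (sym same-state) at-q) (trans (sym same-input) reads-σ)

  enabled-emb-back : ∀ s e c d p → N.Enabled (extend s c) (extendInput e d) (emb p)
    → O.Enabled s e p ⊎ Σ (O.Trans p) λ t → Ready s e p t × guard t (inj₂ c) ≡ true
  enabled-emb-back s e c d pA (t@(_ , _ , g , _) , listed , at-q , reads-σ , w)
    with witness-emb-back {s} {c} {g} pA w
  ... | inj₁ w-old = inj₁ (t , listed , at-q , reads-σ , w-old)
  ... | inj₂ sat   = inj₂ (t , ready listed at-q reads-σ , sat)
  enabled-emb-back s e c d (pB x) (t@(_ , _ , g , _) , listed , at-q , reads-σ , w)
    with witness-emb-back {s} {c} {g} (pB x) w
  ... | inj₁ w-old = inj₁ (t , listed , at-q , reads-σ , w-old)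
  ... | inj₂ sat   = inj₂ (t , ready listed at-q reads-σ , sat)

  enabled-clone-back : ∀ s e i → N.Enabled (extend s (s (pB i))) (extendInput e (e (pB i))) clone
    → Σ (O.Trans (pB i)) λ t → Ready s e (pB i) t × ∃[ p' ] guard {pB i} t (O.tag p' (s p')) ≡ true
  enabled-clone-back s e i (t@(_ , _ , g , _) , listed , at-q , reads-σ , w) =
    t , ready listed at-q reads-σ , witness-clone-back {s} {s (pB i)} {g} w

  step-emb : ∀ {s e s' e'} p c d → O.Step s e p s' e'
    → N.Step (extend s c) (extendInput e d) (emb p) (extend s' c) (extendInput e' d)
  step-emb {s} pA c d (t@(_ , _ , g , _) , (listed , at-q , reads-σ , w) , moved , fr , fi) =
    t , (listed , at-q , reads-σ , witness-emb {s} {c} {g} w) , moved ,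
    extend-frame pA fr , extendInput-frame pA fi
  step-emb {s} (pB x) c d (t@(_ , _ , g , _) , (listed , at-q , reads-σ , w) , moved , fr , fi) =
    t , (listed , at-q , reads-σ , witness-emb {s} {c} {g} w) , moved ,
    extend-frame (pB x) fr , extendInput-frame (pB x) fi

  -- After B_i took a step, the clone (still in B_i's old state and input) can
  -- repeat it: its witness for B_i's guard did not move.
  step-clone : ∀ {s e s' e'} i → O.Step s e (pB i) s' e'
    → N.Step (extend s' (s (pB i))) (extendInput e' (e (pB i))) clone
             (extend s' (s' (pB i))) (extendInput e' (e' (pB i)))
  step-clone {s} {e} {s'} {e'} i
             (t@(_ , _ , g , _) , (listed , at-q , reads-σ , (p' , p'≢i , sat)) , moved , fr , fi) =
    t , (listed , at-q , reads-σ , witness-clone {s'} {s (pB i)} {g} p' sat') , moved ,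
    extend-clone-frame s' (s (pB i)) (s' (pB i)) , extendInput-clone-frame e' (e (pB i)) (e' (pB i))
    where
    sat' : g (O.tag p' (s' p')) ≡ true
    sat' = subst (λ v → g (O.tag p' v) ≡ true) (sym (fr p' p'≢i)) sat

  -- If B_i and B_k (i ≢ k) share their state in a global deadlock, cloning B_i
  -- yields a global deadlock: whatever the clone satisfies, B_i or B_k does too.
  deadlock-clone : ∀ {s e} i k → i ≢ k → s (pB i) ≡ s (pB k) → (∀ p → O.Disabled s e p)
    → ∀ P → N.Disabled (extend s (s (pB i))) (extendInput e (e (pB i))) P
  deadlock-clone {s} {e} i k i≢k twins dead = disabled
    where
    twin-visible : ∀ p g → g (inj₂ (s (pB i))) ≡ true → Witnessed s p g
    twin-visible p g sat with p ≟P pB i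
    ... | yes refl = pB k , i≢k ∘ sym ∘ pB-injective , subst (λ v → g (inj₂ v) ≡ true) twins sat
    ... | no p≢i   = pB i , p≢i ∘ sym , sat

    visible-to-Bi : ∀ g p' → g (O.tag p' (s p')) ≡ true → Witnessed s (pB i) g
    visible-to-Bi g p' sat with p' ≟P pB i
    ... | yes refl  = twin-visible (pB i) g sat
    ... | no p'≢i   = p' , p'≢i , sat

    disabled-emb : ∀ p → N.Disabled (extend s (s (pB i))) (extendInput e (e (pB i))) (emb p)
    disabled-emb p en with enabled-emb-back s e (s (pB i)) (e (pB i)) p en
    ... | inj₁ en-old            = dead p en-old
    ... | inj₂ (t , t-ready , sat) = dead p (ready-enabled t t-ready (twin-visible p (guard t) sat))

    disabled : ∀ P → N.Disabled (extend s (s (pB i))) (extendInput e (e (pB i))) P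
    disabled pA           = disabled-emb pA
    disabled (pB (suc x)) = disabled-emb (pB x)
    disabled (pB zero) en with enabled-clone-back s e i en
    ... | t , t-ready , p' , sat =
      dead (pB i) (ready-enabled t t-ready (visible-to-Bi (guard {pB i} t) p' sat))

  module Replay (st : ℕ → O.GState) (inp : ℕ → O.GInput) (mv : ℕ → Proc n) (i : Fin n) where
    Bi : Proc n
    Bi = pB i

    -- Either the old run is at time j and the clone agrees with B_i, or B_i
    -- has just taken step j and the clone still has to repeat it.
    data Pos : Set where
      before  : ℕ → Pos
      lagging : (j : ℕ) → mv j ≡ Bi → Pos

    time : Pos → ℕ
    time (before j)    = j
    time (lagging j _) = j

    after : (j : ℕ) → Dec (mv j ≡ Bi) → Pos
    after j (yes moved) = lagging j moved
    after j (no _)      = before (suc j)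

    next : Pos → Pos
    next (before j)    = after j (mv j ≟P Bi)
    next (lagging j _) = before (suc j)

    pos : ℕ → Pos
    pos zero    = before 0
    pos (suc k) = next (pos k)

    state : Pos → N.GState
    state (before j)    = extend (st j) (st j Bi)
    state (lagging j _) = extend (st (suc j)) (st j Bi)

    input : Pos → N.GInput
    input (before j)    = extendInput (inp j) (inp j Bi)
    input (lagging j _) = extendInput (inp (suc j)) (inp j Bi)

    mover : Pos → Proc (suc n)
    mover (before j)    = emb (mv j)
    mover (lagging j _) = clone

    OldStep : ℕ → Set
    OldStep j = O.Step (st j) (inp j) (mv j) (st (suc j)) (inp (suc j))

    unmoved : ∀ {j} → OldStep j → ∀ p → p ≢ mv j → st (suc j) p ≡ st j p × inp (suc j) p ≡ inp j p
    unmoved (_ , _ , _ , fr , fi) p p≢mover = fr p p≢mover , fi p p≢mover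

    start-state : (∀ p → st 0 p ≡ O.initState p) → ∀ P → state (pos 0) P ≡ N.initState P
    start-state start pA           = start pA
    start-state start (pB zero)    = start Bi
    start-state start (pB (suc x)) = start (pB x)

    step-at : ∀ c → OldStep (time c)
      → N.Step (state c) (input c) (mover c) (state (next c)) (input (next c))
    step-at (before j) step = step-after (mv j ≟P Bi)
      where
      step-after : (d : Dec (mv j ≡ Bi))
        → N.Step (state (before j)) (input (before j)) (emb (mv j)) (state (after j d)) (input (after j d))
      step-after (yes _)    = step-emb (mv j) (st j Bi) (inp j Bi) step
      step-after (no other) =
        subst₂ (λ c d → N.Step (state (before j)) (input (before j)) (emb (mv j))
                                (extend (st (suc j)) c) (extendInput (inp (suc j)) d))
               (sym (proj₁ (unmoved step Bi (other ∘ sym))))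
               (sym (proj₂ (unmoved step Bi (other ∘ sym))))
               (step-emb (mv j) (st j Bi) (inp j Bi) step)
    step-at (lagging j moved) step =
      step-clone i (subst (λ p → O.Step (st j) (inp j) p (st (suc j)) (inp (suc j))) moved step)

    after-arrives : ∀ j (d : Dec (mv j ≡ Bi))
      → next (after j d) ≡ before (suc j) ⊎ after j d ≡ before (suc j)
    after-arrives j (yes _) = inj₁ refl
    after-arrives j (no _)  = inj₂ refl

    reach : ∀ j → ∃[ k ] pos k ≡ before j
    reach zero = 0 , refl
    reach (suc j) with reach j
    ... | k , at-j with after-arrives j (mv j ≟P Bi)
    ...   | inj₁ in-two = suc (suc k) , trans (cong (next ∘ next) at-j) in-two
    ...   | inj₂ in-one = suc k , trans (cong next at-j) in-one

    time-next : ∀ c → time c ≤ time (next c)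
    time-next (before j) with mv j ≟P Bi
    ... | yes _ = ≤-refl
    ... | no _  = n≤1+n j
    time-next (lagging j _) = n≤1+n j

    time-monotone : ∀ {k k'} → k ≤ k' → time (pos k) ≤ time (pos k')
    time-monotone = stepwise-monotone (time ∘ pos) (time-next ∘ pos)

    rank : Pos → ℕ
    rank (before j)    = j + j
    rank (lagging j _) = suc (j + j)

    rank-next : ∀ c → rank c < rank (next c)
    rank-next (before j) with mv j ≟P Bi
    ... | yes _ = ≤-refl
    ... | no _  = s≤s (+-monoʳ-≤ j (n≤1+n j))
    rank-next (lagging j _) = s≤s (≤-reflexive (sym (+-suc j j)))

    rank-earlier : ∀ {k K} → k < K → rank (pos k) < rank (pos K)
    rank-earlier {k} k<K =
      <-≤-trans (rank-next (pos k)) (stepwise-monotone (rank ∘ pos) (<⇒≤ ∘ rank-next ∘ pos) k<K)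

    -- The rank is at least twice the time, so a rank below that of before j
    -- means a time below j.
    time<-from-rank : ∀ c j → rank c < rank (before j) → time c < j
    time<-from-rank c j r<jj = ≰⇒> λ j≤t → <⇒≱ r<jj (≤-trans (+-mono-≤ j≤t j≤t) (rank-lower c))
      where
      rank-lower : ∀ c → time c + time c ≤ rank c
      rank-lower (before _)    = ≤-refl
      rank-lower (lagging j _) = n≤1+n (j + j)

    earlier-time : ∀ {k K len} → pos K ≡ before len → k < K → time (pos k) < len
    earlier-time {k} {len = len} at-len k<K =
      time<-from-rank (pos k) len (subst (λ c → rank (pos k) < rank c) at-len (rank-earlier k<K))

    -- If p ≢ B_i is disabled from time j₀ on, then emb p is disabled at every
    -- position from j₀ on: the clone's state is B_i's state at that time.
    disabled-after : (∀ j → OldStep j)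
      → ∀ {p j₀} → Bi ≢ p → (∀ k → j₀ ≤ k → O.Disabled (st k) (inp k) p)
      → ∀ c → j₀ ≤ time c → N.Disabled (state c) (input c) (emb p)
    disabled-after steps {p} Bi≢p dis (before j) j₀≤j en
      with enabled-emb-back (st j) (inp j) (st j Bi) (inp j Bi) p en
    ... | inj₁ en-old            = dis j j₀≤j en-old
    ... | inj₂ (t , t-ready , sat) = dis j j₀≤j (ready-enabled t t-ready (Bi , Bi≢p , sat))
    disabled-after steps {p} Bi≢p dis (lagging j moved) j₀≤j en
      with enabled-emb-back (st (suc j)) (inp (suc j)) (st j Bi) (inp j Bi) p en
    ... | inj₁ en-old            = dis (suc j) (m≤n⇒m≤1+n j₀≤j) en-old
    ... | inj₂ (t , ready-now , sat) = dis j j₀≤j (ready-enabled t ready-before (Bi , Bi≢p , sat))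
      where
      p≢mover : p ≢ mv j
      p≢mover p≡mv = Bi≢p (sym (trans p≡mv moved))

      ready-before : Ready (st j) (inp j) p t
      ready-before = ready-frame t (proj₁ (unmoved (steps j) p p≢mover))
                                   (proj₂ (unmoved (steps j) p p≢mover)) ready-now

  global-deadlock : b < n → O.FiniteRun → N.FiniteRun
  global-deadlock b<n run with pigeonhole b<n (λ x → O.FiniteRun.st run (O.FiniteRun.len run) (pB x))
  ... | i , k , i<k , twins = record
    { len   = K
    ; st    = state ∘ pos
    ; inp   = input ∘ pos
    ; mv    = mover ∘ pos
    ; start = start-state start
    ; steps = λ m m<K → step-at (pos m) (steps (time (pos m)) (earlier-time at-len m<K))
    ; final = subst (λ c → ∀ P → N.Disabled (state c) (input c) P) (sym at-len)
                    (deadlock-clone i k (<⇒≢ i<k) twins final)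
    }
    where
    open O.FiniteRun run
    open Replay st inp mv i
    K : ℕ
    K = proj₁ (reach len)
    at-len : pos K ≡ before len
    at-len = proj₂ (reach len)

  local-deadlock : 2 ≤ n → (run : O.InfiniteRun) → O.LocallyDeadlocked run
    → Σ N.InfiniteRun N.LocallyDeadlocked
  local-deadlock 2≤n run (p , j₀ , dis) =
    record
      { st    = state ∘ pos
      ; inp   = input ∘ pos
      ; mv    = mover ∘ pos
      ; start = start-state start
      ; steps = λ m → step-at (pos m) (steps (time (pos m)))
      }
    , emb p , K , λ m K≤m →
        disabled-after steps Bi≢p dis (pos m)
          (subst (_≤ time (pos m)) (cong time at-j₀) (time-monotone K≤m))
    where
    open O.InfiniteRun run
    i : Fin n
    i = proj₁ (another-B p 2≤n)
    Bi≢p : pB i ≢ p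
    Bi≢p = proj₂ (another-B p 2≤n)
    open Replay st inp mv i
    K : ℕ
    K = proj₁ (reach j₀)
    at-j₀ : pos K ≡ before j₀
    at-j₀ = proj₂ (reach j₀)

mainTheorem9 : (a b : ℕ) (A : Template (Fin a) a b) (B : Template (Fin b) a b)
    → (n : ℕ) → b + 1 ≤ n → HasDeadlock A B n → HasDeadlock A B (suc n)
mainTheorem9 a b A B n b+1≤n =
  Sum.map (global-deadlock b<n) λ (run , locked) → local-deadlock 2≤n run locked
  where
  open Shadow A B n
  b<n : b < n
  b<n = subst (_≤ n) (+-comm b 1) b+1≤n
  -- B has an initial state, so |B| ≥ 1 and hence n ≥ 2.
  2≤n : 2 ≤ n
  2≤n = ≤-trans (s≤s (inhabited-positive (init B))) b<n
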